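{- Let $\mathcal{C}$ be a nice clustering for a facility location instance $(F,D)$, and let $(x,y)$ and $\alpha$ be constructed from $\mathcal{C}$ as in the context. Then $\sum_{i\in F} f_i\, y_i+\sum_{i\in F,\,j\in D} d_{ij}\, x_{ij}\le\sum_{j\in D}\alpha_j$.
   Context: Facility location: finite facility set $F$, finite client set $D$, in a common metric space; $d_{ij}>0$ is the distance between facility $i$ and client $j$ (triangle inequality holds), $f_i\ge0$ the opening cost of facility $i$. Clusters: a cluster is a pair $C=(i,A)$ with $i\in F$, $A\subseteq D$, designated critical or satellite; satellite clusters have exactly one client. $cost(C)=\sum_{j\in A}d_{ij}$ if satellite, $f_i+\sum_{j\in A}d_{ij}$ if critical; $cost_{avg}(C)=cost(C)/|A|$. A clustering is a collection $\mathcal{C}$ of clusters in which every client of $D$ lies in exactly one cluster and, for each facility $i$ with $\mathcal{C}(i)$ (clusters of $\mathcal{C}$ with facility $i$) nonempty, exactly one cluster of $\mathcal{C}(i)$ is critical. Each $C\in\mathcal{C}$ has a level $\ell(C)\in\mathbb{Z}$; $\ell(j)=\ell(C)$ for clients $j$ of $C$. $\kappa^*_{ij}$ is the unique integer with $2^{\kappa^*_{ij}-4}\le d_{ij}<2^{\kappa^*_{ij}-3}$. A cluster $C=(i,A)$ (not necessarily in $\mathcal{C}$) is blocking at level $k$ w.r.t. $\mathcal{C}$ if (a) $cost_{avg}(C)<2^{k-3}$; (b) $\ell(j)>k\ge\kappa^*_{ij}$ for all $j\in A$; (c) if $C$ is satellite, some critical $C^*\in\mathcal{C}(i)$ has $\ell(C^*)\le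 k$; if $C$ is critical, $k\le\ell(C')$ for all $C'\in\mathcal{C}(i)$. $\mathcal{C}$ is nice if (I1) $cost_{avg}(C)<2^{\ell(C)}$ for all $C\in\mathcal{C}$; (I2) for each $i$ with $\mathcal{C}(i)\ne\emptyset$ the critical cluster $C^*\in\mathcal{C}(i)$ has $\ell(C^*)\le\ell(C)$ for all $C\in\mathcal{C}(i)$; (I3) $\ell(j)\ge\kappa^*_{ij}$ for every $C=(i,A)\in\mathcal{C}$, $j\in A$; (I4) no cluster is blocking at any level w.r.t. $\mathcal{C}$. Construction: $y_i=1$ if $\mathcal{C}(i)\ne\emptyset$ and $y_i=0$ otherwise; $x_{ij}=1$ if client $j$ lies in a cluster of $\mathcal{C}$ with facility $i$ and $x_{ij}=0$ otherwise; for each client $j$, $\alpha_j=2^{\ell(j)}$.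
   Formalization: The distances $d_{ij}$ and the opening costs $f_i$ are rational. -}

module Defs where

open import Data.Nat using (ℕ; zero; suc)
open import Data.Integer using (ℤ; +_; -[1+_]) renaming (_+_ to _+ℤ_; _-_ to _-ℤ_; _≤_ to _≤ℤ_; _<_ to _<ℤ_)
open import Data.Rational using (ℚ; 0ℚ; 1ℚ; ½; _+_; _*_; _≤_; _<_) renaming (_/_ to _/ℚ_)
open import Data.Fin using (Fin; zero; suc; _≟_)
open import Data.Fin.Subset using (Subset; _∈_; ∣_∣)
open import Data.Fin.Properties using (any?)
open import Data.Bool using (Bool; true; false; if_then_else_)
open import Data.Product using (Σ; _×_; _,_; proj₁; ∃)
open import Data.Vec using (lookup)
open import Relation.Binary.PropositionalEquality using (_≡_)
open import Relation.Nullary using (¬_; Dec; yes; no)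
open import Relation.Nullary.Decidable using (⌊_⌋)

ℕ→ℚ : ℕ → ℚ
ℕ→ℚ n = + n /ℚ 1

pow2ℕ : ℕ → ℚ
pow2ℕ zero = 1ℚ
pow2ℕ (suc n) = (+ 2 /ℚ 1) * pow2ℕ n

half^ : ℕ → ℚ
half^ zero = 1ℚ
half^ (suc n) = ½ * half^ n

pow2 : ℤ → ℚ
pow2 (+ n) = pow2ℕ n
pow2 -[1+ n ] = half^ (suc n)

Σℚ : {n : ℕ} → (Fin n → ℚ) → ℚ
Σℚ {zero} g = 0ℚ
Σℚ {suc n} g = g zero + Σℚ (λ j → g (suc j))

_∈ᵇ_ : {n : ℕ} → Fin n → Subset n → Bool
j ∈ᵇ A = lookup A j

-- Facility location instance: facilities Fin m, clients Fin n

record Instance (m n : ℕ) : Set where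
  field
    d : Fin m → Fin n → ℚ
    f : Fin m → ℚ
    d-pos : ∀ i j → 0ℚ < d i j
    f-nonneg : ∀ i → 0ℚ ≤ f i
    -- triangle inequality (facilities and clients lie in a common metric space)
    d-tri : ∀ i j i' j' → d i j ≤ d i j' + d i' j' + d i' j

IsKappa : ℚ → ℤ → Set
IsKappa δ κ = (pow2 (κ -ℤ + 4) ≤ δ) × (δ < pow2 (κ -ℤ + 3))

-- "k ≥ κ*" where κ* is the integer characterised by IsKappa
κ*≤ : ℚ → ℤ → Set
κ*≤ δ k = ∀ κ → IsKappa δ κ → κ ≤ℤ k

record Cluster (m n : ℕ) : Set where
  constructor cluster
  field
    fac : Fin m
    clients : Subset n
    critical : Bool     -- true = critical, false = satellite

open Cluster public

WellFormed : {m n : ℕ} → Cluster m n → Set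
WellFormed C = critical C ≡ false → ∣ clients C ∣ ≡ 1

module _ {m n : ℕ} (I : Instance m n) where
  open Instance I

  cost : Cluster m n → ℚ
  cost C = (if critical C then f (fac C) else 0ℚ)
           + Σℚ (λ j → if j ∈ᵇ clients C then d (fac C) j else 0ℚ)

  -- cost_avg(C) < t, i.e. cost(C)/|A| < t (A nonempty)
  AvgLess : Cluster m n → ℚ → Set
  AvgLess C t = (0 Data.Nat.< ∣ clients C ∣) × (cost C < ℕ→ℚ ∣ clients C ∣ * t)

  record Clustering : Set where
    field
      k : ℕ
      cl : Fin k → Cluster m n
      level : Fin k → ℤ
      wf : ∀ c → WellFormed (cl c)
      clusterOf : Fin n → Fin k
      clusterOf-∈ : ∀ j → j ∈ clients (cl (clusterOf j))
      clusterOf-unique : ∀ j c → j ∈ clients (cl c) → c ≡ clusterOf j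
      crit-exists : ∀ c → Σ (Fin k) λ c' → (fac (cl c') ≡ fac (cl c)) × (critical (cl c') ≡ true)
      crit-unique : ∀ c c' → fac (cl c) ≡ fac (cl c') → critical (cl c) ≡ true → critical (cl c') ≡ true → c ≡ c'

    ℓ : Fin n → ℤ
    ℓ j = level (clusterOf j)

  open Clustering public

  Blocking : Clustering → Cluster m n → ℤ → Set
  Blocking 𝒞 C κ =
      AvgLess C (pow2 (κ -ℤ + 3))
    × (∀ j → j ∈ clients C → (κ <ℤ ℓ 𝒞 j) × κ*≤ (d (fac C) j) κ)
    × (critical C ≡ false → Σ (Fin (k 𝒞)) λ c → (fac (cl 𝒞 c) ≡ fac C) × (critical (cl 𝒞 c) ≡ true) × (level 𝒞 c ≤ℤ κ))
    × (critical C ≡ true → ∀ c → fac (cl 𝒞 c) ≡ fac C → κ ≤ℤ level 𝒞 c)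

  record Nice (𝒞 : Clustering) : Set where
    field
      I1 : ∀ c → AvgLess (cl 𝒞 c) (pow2 (level 𝒞 c))
      I2 : ∀ c c' → fac (cl 𝒞 c) ≡ fac (cl 𝒞 c') → critical (cl 𝒞 c) ≡ true → level 𝒞 c ≤ℤ level 𝒞 c'
      I3 : ∀ c j → j ∈ clients (cl 𝒞 c) → κ*≤ (d (fac (cl 𝒞 c)) j) (level 𝒞 c)
      I4 : ∀ C κ → WellFormed C → ¬ Blocking 𝒞 C κ

  yᶜ : Clustering → Fin m → ℚ
  yᶜ 𝒞 i = if ⌊ any? (λ c → fac (cl 𝒞 c) ≟ i) ⌋ then 1ℚ else 0ℚ

  xᶜ : Clustering → Fin m → Fin n → ℚ
  xᶜ 𝒞 i j = if ⌊ fac (cl 𝒞 (clusterOf 𝒞 j)) ≟ i ⌋ then 1ℚ else 0ℚ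

  αᶜ : Clustering → Fin n → ℚ
  αᶜ 𝒞 j = pow2 (ℓ 𝒞 j)

  primalCost : Clustering → ℚ
  primalCost 𝒞 = Σℚ (λ i → f i * yᶜ 𝒞 i) + Σℚ (λ i → Σℚ (λ j → d i j * xᶜ 𝒞 i j))

  dualValue : Clustering → ℚ
  dualValue 𝒞 = Σℚ (αᶜ 𝒞)

-- The primal cost of (x, y) is exactly the total cost of the
-- clusters, since every client is connected to the facility of its own
-- cluster and every open facility is paid for once, by its unique critical
-- cluster.  By (I1) a cluster C = (i, A) costs at most |A| 2^ℓ(C), which is the
-- dual value of its clients; summing over the clusters gives the bound.
-- Only (I1) is needed.
module Submission where

open import Defs
open import Data.Nat using (ℕ)
open import Data.Rational using (_≤_)

open import Algebra.Bundles using (CommutativeMonoid; Ring)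
open import Data.Bool using (true; false; if_then_else_; _∧_)
open import Data.Empty using (⊥-elim)
open import Data.Fin using (Fin; zero; suc; _≟_; punchIn)
open import Data.Fin.Properties using (any?; punchInᵢ≢i)
open import Data.Fin.Subset using (Subset; _∈_; ∣_∣)
import Data.Nat as ℕ
import Data.Integer as ℤ
import Data.Integer.Properties as ℤ
open import Data.Nat.Coprimality using (Coprime; 1-coprimeTo) renaming (sym to coprime-sym)
open import Data.Product using (_,_; proj₁; proj₂)
open import Data.Rational using (ℚ; mkℚ; 0ℚ; 1ℚ; _+_; _*_; _/_)
open import Data.Rational.Properties
  using ( +-0-commutativeMonoid; +-*-ring; normalize-coprime; ≤-refl; <⇒≤; +-mono-≤
        ; +-identityˡ; *-identityˡ; *-identityʳ; *-zeroˡ; *-zeroʳ; *-distribʳ-+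
        ; module ≤-Reasoning)
open import Data.Vec using ([]; _∷_; lookup)
open import Data.Vec.Properties using ([]=⇒lookup; lookup⇒[]=)
open import Function using (_∘_)
open import Relation.Binary.PropositionalEquality
  using (_≡_; _≢_; refl; sym; trans; cong; cong₂; module ≡-Reasoning)
open import Relation.Nullary using (yes; no)
open import Relation.Nullary.Decidable using (⌊_⌋)

module _ {a ℓ} (M : CommutativeMonoid a ℓ) where
  open CommutativeMonoid M using (Carrier; _≈_; _∙_; ε; setoid; ∙-congˡ; identityʳ)
    renaming (trans to ≈-trans)
  open import Algebra.Properties.CommutativeMonoid.Sum M
  open import Relation.Binary.Reasoning.Setoid setoid

  sum-single : ∀ {n} (g : Fin n → Carrier) (i₀ : Fin n) →
               (∀ i → i ≢ i₀ → g i ≈ ε) → sum g ≈ g i₀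
  sum-single {ℕ.suc n} g i₀ vanish = begin
    sum g                         ≈⟨ sum-remove g ⟩
    g i₀ ∙ sum (g ∘ punchIn i₀)   ≈⟨ ∙-congˡ rest≈ε ⟩
    g i₀ ∙ ε                      ≈⟨ identityʳ (g i₀) ⟩
    g i₀                          ∎
    where
    rest≈ε : sum (g ∘ punchIn i₀) ≈ ε
    rest≈ε = ≈-trans (sum-cong-≋ (λ j → vanish (punchIn i₀ j) (punchInᵢ≢i i₀ j)))
                     (sum-replicate-zero n)

open import Algebra.Properties.Semiring.Sum (Ring.semiring +-*-ring)
  using (sum; sum-syntax; sum-cong-≗; sum-replicate-zero; ∑-comm; ∑-distrib-+; *-distribˡ-sum)

sum-mono-≤ : ∀ {n} {g h : Fin n → ℚ} → (∀ i → g i ≤ h i) → sum g ≤ sum h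
sum-mono-≤ {ℕ.zero}  _   = ≤-refl
sum-mono-≤ {ℕ.suc n} g≤h = +-mono-≤ (g≤h zero) (sum-mono-≤ (g≤h ∘ suc))

Σℚ≡sum : ∀ {n} (g : Fin n → ℚ) → Σℚ g ≡ sum g
Σℚ≡sum {ℕ.zero}  g = refl
Σℚ≡sum {ℕ.suc n} g = cong (g zero +_) (Σℚ≡sum (g ∘ suc))

Σℚ²≡sum² : ∀ {m n} (g : Fin m → Fin n → ℚ) →
           Σℚ (λ i → Σℚ (g i)) ≡ ∑[ i < m ] ∑[ j < n ] g i j
Σℚ²≡sum² g = trans (Σℚ≡sum (λ i → Σℚ (g i))) (sum-cong-≗ (λ i → Σℚ≡sum (g i)))

sum-*-δ : ∀ {m} (h : Fin m → ℚ) (a : Fin m) →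
          ∑[ i < m ] (h i * (if ⌊ a ≟ i ⌋ then 1ℚ else 0ℚ)) ≡ h a
sum-*-δ h a = trans (sum-single +-0-commutativeMonoid _ a vanish) at-a
  where
  vanish : ∀ i → i ≢ a → h i * (if ⌊ a ≟ i ⌋ then 1ℚ else 0ℚ) ≡ 0ℚ
  vanish i i≢a with a ≟ i
  ... | yes a≡i = ⊥-elim (i≢a (sym a≡i))
  ... | no _    = *-zeroʳ (h i)
  at-a : h a * (if ⌊ a ≟ a ⌋ then 1ℚ else 0ℚ) ≡ h a
  at-a with a ≟ a
  ... | yes _   = *-identityʳ (h a)
  ... | no a≢a  = ⊥-elim (a≢a refl)

-- ℕ→ℚ n = + n / 1 normalises through gcd n 1, which does not compute for a
-- variable n; normalize-coprime replaces it by the normal form mkℚ (+ n) 0 _.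
ℕ→ℚ-suc : ∀ n → ℕ→ℚ (ℕ.suc n) ≡ 1ℚ + ℕ→ℚ n
ℕ→ℚ-suc n = begin
  ℤ.+ ℕ.suc n / 1              ≡⟨ cong (λ z → (ℤ.+ 1 ℤ.+ z) / 1) (sym (ℤ.*-identityʳ (ℤ.+ n))) ⟩
  1ℚ + mkℚ (ℤ.+ n) 0 coprime   ≡⟨ cong (1ℚ +_) (normalize-coprime coprime) ⟨
  1ℚ + ℕ→ℚ n                   ∎
  where
  open ≡-Reasoning
  coprime : Coprime n 1
  coprime = coprime-sym (1-coprimeTo n)

∣A∣*x≡∑ : ∀ {n} (A : Subset n) (x : ℚ) →
          ℕ→ℚ ∣ A ∣ * x ≡ ∑[ j < n ] (if j ∈ᵇ A then x else 0ℚ)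
∣A∣*x≡∑ []          x = *-zeroˡ x
∣A∣*x≡∑ (true ∷ A)  x = begin
  ℕ→ℚ (ℕ.suc ∣ A ∣) * x            ≡⟨ cong (_* x) (ℕ→ℚ-suc ∣ A ∣) ⟩
  (1ℚ + ℕ→ℚ ∣ A ∣) * x             ≡⟨ *-distribʳ-+ x 1ℚ (ℕ→ℚ ∣ A ∣) ⟩
  1ℚ * x + ℕ→ℚ ∣ A ∣ * x           ≡⟨ cong₂ _+_ (*-identityˡ x) (∣A∣*x≡∑ A x) ⟩
  x + ∑[ j < _ ] (if j ∈ᵇ A then x else 0ℚ)  ∎
  where open ≡-Reasoning
∣A∣*x≡∑ (false ∷ A) x = trans (∣A∣*x≡∑ A x) (sym (+-identityˡ _))

sum-partition : ∀ {k n} (A : Fin k → Subset n) (π : Fin n → Fin k) →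
                (∀ j → j ∈ A (π j)) → (∀ j c → j ∈ A c → c ≡ π j) →
                (h : Fin k → Fin n → ℚ) →
                ∑[ c < k ] ∑[ j < n ] (if j ∈ᵇ A c then h c j else 0ℚ) ≡ ∑[ j < n ] h (π j) j
sum-partition A π ∈-π π-unique h =
  trans (∑-comm (λ c j → if j ∈ᵇ A c then h c j else 0ℚ))
        (sum-cong-≗ λ j → trans (sum-single +-0-commutativeMonoid _ (π j) (vanish j)) (at-π j))
  where
  vanish : ∀ j c → c ≢ π j → (if j ∈ᵇ A c then h c j else 0ℚ) ≡ 0ℚ
  vanish j c c≢πj with lookup (A c) j in j∈?c
  ... | true  = ⊥-elim (c≢πj (π-unique j c (lookup⇒[]= j (A c) j∈?c)))
  ... | false = refl
  at-π : ∀ j → (if j ∈ᵇ A (π j) then h (π j) j else 0ℚ) ≡ h (π j) j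
  at-π j rewrite []=⇒lookup (∈-π j) = refl

module _ {m n : ℕ} (I : Instance m n) (𝒞 : Clustering I) where
  open Instance I

  members : Fin (k 𝒞) → Subset n
  members c = clients (cl 𝒞 c)

  sum-by-cluster : (h : Fin (k 𝒞) → Fin n → ℚ) →
                   ∑[ c < k 𝒞 ] ∑[ j < n ] (if j ∈ᵇ members c then h c j else 0ℚ) ≡
                   ∑[ j < n ] h (clusterOf 𝒞 j) j
  sum-by-cluster = sum-partition members (clusterOf 𝒞) (clusterOf-∈ 𝒞) (clusterOf-unique 𝒞)

  openingCharge : Fin (k 𝒞) → ℚ
  openingCharge c = if critical (cl 𝒞 c) then f (fac (cl 𝒞 c)) else 0ℚ

  criticalAt : Fin (k 𝒞) → Fin m → ℚ
  criticalAt c i = if critical (cl 𝒞 c) ∧ ⌊ fac (cl 𝒞 c) ≟ i ⌋ then 1ℚ else 0ℚ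

  openingCharge≡∑ : ∀ c → openingCharge c ≡ ∑[ i < m ] (f i * criticalAt c i)
  openingCharge≡∑ c with critical (cl 𝒞 c)
  ... | true  = sym (sum-*-δ f (fac (cl 𝒞 c)))
  ... | false = sym (trans (sum-cong-≗ (λ i → *-zeroʳ (f i))) (sum-replicate-zero m))

  ∑criticalAt≡yᶜ : ∀ i → ∑[ c < k 𝒞 ] criticalAt c i ≡ yᶜ I 𝒞 i
  ∑criticalAt≡yᶜ i with any? (λ c → fac (cl 𝒞 c) ≟ i)
  ... | yes (c₁ , c₁↦i) = trans (sum-single +-0-commutativeMonoid _ c₀ vanish) at-c₀
    where
    c₀ : Fin (k 𝒞)
    c₀ = proj₁ (crit-exists 𝒞 c₁)
    c₀↦i : fac (cl 𝒞 c₀) ≡ i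
    c₀↦i = trans (proj₁ (proj₂ (crit-exists 𝒞 c₁))) c₁↦i
    c₀-critical : critical (cl 𝒞 c₀) ≡ true
    c₀-critical = proj₂ (proj₂ (crit-exists 𝒞 c₁))
    vanish : ∀ c → c ≢ c₀ → criticalAt c i ≡ 0ℚ
    vanish c c≢c₀ with critical (cl 𝒞 c) in c-critical
    ... | false = refl
    ... | true with fac (cl 𝒞 c) ≟ i
    ...   | yes c↦i =
      ⊥-elim (c≢c₀ (crit-unique 𝒞 c c₀ (trans c↦i (sym c₀↦i)) c-critical c₀-critical))
    ...   | no _    = refl
    at-c₀ : criticalAt c₀ i ≡ 1ℚ
    at-c₀ rewrite c₀-critical with fac (cl 𝒞 c₀) ≟ i
    ... | yes _      = refl
    ... | no c₀↦̸i  = ⊥-elim (c₀↦̸i c₀↦i)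
  ... | no ∄c↦i = trans (sum-cong-≗ vanish) (sum-replicate-zero (k 𝒞))
    where
    vanish : ∀ c → criticalAt c i ≡ 0ℚ
    vanish c with critical (cl 𝒞 c)
    ... | false = refl
    ... | true with fac (cl 𝒞 c) ≟ i
    ...   | yes c↦i = ⊥-elim (∄c↦i (c , c↦i))
    ...   | no _    = refl

  ∑f*yᶜ≡∑openingCharge : ∑[ i < m ] (f i * yᶜ I 𝒞 i) ≡ ∑[ c < k 𝒞 ] openingCharge c
  ∑f*yᶜ≡∑openingCharge = begin
    ∑[ i < m ] (f i * yᶜ I 𝒞 i)
      ≡⟨ sum-cong-≗ (λ i → cong (f i *_) (∑criticalAt≡yᶜ i)) ⟨
    ∑[ i < m ] (f i * ∑[ c < k 𝒞 ] criticalAt c i)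
      ≡⟨ sum-cong-≗ (λ i → *-distribˡ-sum (f i) (λ c → criticalAt c i)) ⟩
    ∑[ i < m ] ∑[ c < k 𝒞 ] (f i * criticalAt c i)
      ≡⟨ ∑-comm (λ i c → f i * criticalAt c i) ⟩
    ∑[ c < k 𝒞 ] ∑[ i < m ] (f i * criticalAt c i)
      ≡⟨ sum-cong-≗ openingCharge≡∑ ⟨
    ∑[ c < k 𝒞 ] openingCharge c
      ∎
    where open ≡-Reasoning

  ∑d*xᶜ≡∑d[clusterOf] : ∑[ i < m ] ∑[ j < n ] (d i j * xᶜ I 𝒞 i j) ≡
                        ∑[ j < n ] d (fac (cl 𝒞 (clusterOf 𝒞 j))) j
  ∑d*xᶜ≡∑d[clusterOf] = trans (∑-comm (λ i j → d i j * xᶜ I 𝒞 i j))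
    (sum-cong-≗ (λ j → sum-*-δ (λ i → d i j) (fac (cl 𝒞 (clusterOf 𝒞 j)))))

  connection : Fin (k 𝒞) → Fin n → ℚ
  connection c j = if j ∈ᵇ members c then d (fac (cl 𝒞 c)) j else 0ℚ

  primalCost≡∑cost : primalCost I 𝒞 ≡ ∑[ c < k 𝒞 ] cost I (cl 𝒞 c)
  primalCost≡∑cost = begin
    primalCost I 𝒞
      ≡⟨ cong₂ _+_ (Σℚ≡sum (λ i → f i * yᶜ I 𝒞 i)) (Σℚ²≡sum² (λ i j → d i j * xᶜ I 𝒞 i j)) ⟩
    ∑[ i < m ] (f i * yᶜ I 𝒞 i) + ∑[ i < m ] ∑[ j < n ] (d i j * xᶜ I 𝒞 i j)
      ≡⟨ cong₂ _+_ ∑f*yᶜ≡∑openingCharge ∑d*xᶜ≡∑d[clusterOf] ⟩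
    ∑[ c < k 𝒞 ] openingCharge c + ∑[ j < n ] d (fac (cl 𝒞 (clusterOf 𝒞 j))) j
      ≡⟨ cong (∑[ c < k 𝒞 ] openingCharge c +_) (sum-by-cluster (λ c → d (fac (cl 𝒞 c)))) ⟨
    ∑[ c < k 𝒞 ] openingCharge c + ∑[ c < k 𝒞 ] ∑[ j < n ] connection c j
      ≡⟨ ∑-distrib-+ openingCharge (λ c → ∑[ j < n ] connection c j) ⟨
    ∑[ c < k 𝒞 ] (openingCharge c + ∑[ j < n ] connection c j)
      ≡⟨ sum-cong-≗ (λ c → cong (openingCharge c +_) (Σℚ≡sum (connection c))) ⟨
    ∑[ c < k 𝒞 ] cost I (cl 𝒞 c)
      ∎
    where open ≡-Reasoning

  ∑cost≤∑bound : (t : Fin (k 𝒞) → ℚ) → (∀ c → AvgLess I (cl 𝒞 c) (t c)) →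
                 ∑[ c < k 𝒞 ] cost I (cl 𝒞 c) ≤ ∑[ j < n ] t (clusterOf 𝒞 j)
  ∑cost≤∑bound t avg<t = begin
    ∑[ c < k 𝒞 ] cost I (cl 𝒞 c)
      ≤⟨ sum-mono-≤ (λ c → <⇒≤ (proj₂ (avg<t c))) ⟩
    ∑[ c < k 𝒞 ] (ℕ→ℚ ∣ members c ∣ * t c)
      ≡⟨ sum-cong-≗ (λ c → ∣A∣*x≡∑ (members c) (t c)) ⟩
    ∑[ c < k 𝒞 ] ∑[ j < n ] (if j ∈ᵇ members c then t c else 0ℚ)
      ≡⟨ sum-by-cluster (λ c _ → t c) ⟩
    ∑[ j < n ] t (clusterOf 𝒞 j)
      ∎
    where open ≤-Reasoning

lemma3 : (m n : ℕ) (I : Instance m n) (𝒞 : Clustering I) → Nice I 𝒞 →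
           primalCost I 𝒞 ≤ dualValue I 𝒞
lemma3 m n I 𝒞 nice = begin
  primalCost I 𝒞                           ≡⟨ primalCost≡∑cost I 𝒞 ⟩
  ∑[ c < k 𝒞 ] cost I (cl 𝒞 c)             ≤⟨ ∑cost≤∑bound I 𝒞 (pow2 ∘ level 𝒞) (Nice.I1 nice) ⟩
  ∑[ j < n ] αᶜ I 𝒞 j                      ≡⟨ Σℚ≡sum (αᶜ I 𝒞) ⟨
  dualValue I 𝒞                            ∎
  where open ≤-Reasoning
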